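{- For every integer $n\ge 0$, \[ \binom{2n}{n}\sum_{k=0}^{n}\binom{n}{k}^2\binom{n+k}{n}\binom{2k}{n}=\binom{2n}{n}\sum_{k=0}^{n}\binom{n}{k}^2\binom{n+k}{k}\binom{2n-k}{n}. \]
   Context: $\binom{m}{j}$ is the usual binomial coefficient for integers $m\ge0$, with $\binom{m}{j}=0$ if $j<0$ or $j>m$. -}

module Defs where

open import Data.Nat using (ℕ; zero; suc; _+_)

sumTo : ℕ → (ℕ → ℕ) → ℕ
sumTo zero    f = f 0
sumTo (suc n) f = sumTo n f + f (suc n)

-- Expanding C(2k,n) = Σⱼ C(k,j) C(k,n-j) by Vandermonde's convolution and exchanging the sums,
-- it suffices to show, for each j ≤ n and m = n - j, that
--   Σₖ C(n,k)² C(n+k,n) C(k,j) C(k,m) = C(n,j)² C(n+j,j) C(n+m,n).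
-- The subset-of-a-subset identity C(n,k) C(k,j) = C(n,j) C(n-j,n-k) pulls C(n,j) C(n,m) out of
-- the summand; reversing the order of summation, what remains is Li Shanlan's identity
--   Σₜ C(m,t) C(j,t) C(x+m+j-t, m+j) = C(x+m,m) C(x+j,j)
-- at x = n. It is proved by expanding C((x+m)+(j-t), m+j) by Vandermonde, exchanging the sums,
-- and summing over t by Vandermonde again.

module Submission where

open import Defs
open import Data.Nat.Base
open import Function.Base using (_∘_)
open import Data.Nat.Properties
open import Algebra.Properties.CommutativeSemigroup +-commutativeSemigroup using () renaming (interchange to +-interchange; x∙yz≈y∙xz to x+[y+z]≡y+[x+z])
open import Algebra.Properties.CommutativeSemigroup *-commutativeSemigroup using () renaming (xy∙z≈xz∙y to [x*y]*z≡[x*z]*y)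
open import Data.Nat.Combinatorics
open import Data.Nat.DivMod using (m/n*n≡m)
open import Relation.Binary.PropositionalEquality
open import Relation.Nullary using (Dec; yes; no)
open import Data.Nat.Solver using (module +-*-Solver)
open +-*-Solver
open ≡-Reasoning

sumTo-cong : ∀ n {f g : ℕ → ℕ} → (∀ k → k ≤ n → f k ≡ g k) → sumTo n f ≡ sumTo n g
sumTo-cong zero    f≗g = f≗g 0 z≤n
sumTo-cong (suc n) f≗g =
  cong₂ _+_ (sumTo-cong n (λ k k≤n → f≗g k (m≤n⇒m≤1+n k≤n))) (f≗g (suc n) ≤-refl)

sumTo-suc : ∀ n (f : ℕ → ℕ) → sumTo (suc n) f ≡ f 0 + sumTo n (f ∘ suc)
sumTo-suc zero    f = refl
sumTo-suc (suc n) f = begin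
  sumTo (suc n) f + f (suc (suc n))                 ≡⟨ cong (_+ f (suc (suc n))) (sumTo-suc n f) ⟩
  f 0 + sumTo n (f ∘ suc) + f (suc (suc n))        ≡⟨ +-assoc (f 0) _ _ ⟩
  f 0 + (sumTo n (f ∘ suc) + f (suc (suc n)))      ∎

*-distribˡ-sumTo : ∀ n c (f : ℕ → ℕ) → c * sumTo n f ≡ sumTo n (λ k → c * f k)
*-distribˡ-sumTo zero    c f = refl
*-distribˡ-sumTo (suc n) c f =
  trans (*-distribˡ-+ c (sumTo n f) (f (suc n))) (cong (_+ c * f (suc n)) (*-distribˡ-sumTo n c f))

sumTo-distrib-+ : ∀ n (f g : ℕ → ℕ) → sumTo n (λ k → f k + g k) ≡ sumTo n f + sumTo n g
sumTo-distrib-+ zero    f g = refl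
sumTo-distrib-+ (suc n) f g = begin
  sumTo n (λ k → f k + g k) + (f (suc n) + g (suc n))
    ≡⟨ cong (_+ (f (suc n) + g (suc n))) (sumTo-distrib-+ n f g) ⟩
  sumTo n f + sumTo n g + (f (suc n) + g (suc n))
    ≡⟨ +-interchange (sumTo n f) (sumTo n g) (f (suc n)) (g (suc n)) ⟩
  sumTo n f + f (suc n) + (sumTo n g + g (suc n)) ∎

sumTo-comm : ∀ m n (f : ℕ → ℕ → ℕ) →
  sumTo m (λ i → sumTo n (f i)) ≡ sumTo n (λ j → sumTo m (λ i → f i j))
sumTo-comm zero    n f = refl
sumTo-comm (suc m) n f = trans (cong (_+ sumTo n (f (suc m))) (sumTo-comm m n f))
  (sym (sumTo-distrib-+ n (λ j → sumTo m (λ i → f i j)) (f (suc m))))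

sumTo-reverse : ∀ n (f : ℕ → ℕ) → sumTo n f ≡ sumTo n (λ k → f (n ∸ k))
sumTo-reverse zero    f = refl
sumTo-reverse (suc n) f = begin
  sumTo n f + f (suc n)                  ≡⟨ +-comm (sumTo n f) _ ⟩
  f (suc n) + sumTo n f                  ≡⟨ cong (f (suc n) +_) (sumTo-reverse n f) ⟩
  f (suc n) + sumTo n (λ k → f (n ∸ k))  ≡⟨ sumTo-suc n (λ k → f (suc n ∸ k)) ⟨
  sumTo (suc n) (λ k → f (suc n ∸ k))    ∎

sumTo-extend : ∀ m d {f : ℕ → ℕ} → (∀ k → m < k → f k ≡ 0) → sumTo (m + d) f ≡ sumTo m f
sumTo-extend m zero    {f} f>m≡0 = cong (λ x → sumTo x f) (+-identityʳ m)
sumTo-extend m (suc d) {f} f>m≡0 = begin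
  sumTo (m + suc d) f                ≡⟨ cong (λ x → sumTo x f) (+-suc m d) ⟩
  sumTo (m + d) f + f (suc (m + d))  ≡⟨ cong₂ _+_ (sumTo-extend m d f>m≡0) (f>m≡0 _ (s≤s (m≤m+n m d))) ⟩
  sumTo m f + 0                      ≡⟨ +-identityʳ _ ⟩
  sumTo m f                          ∎

sumTo-shift : ∀ m n {f : ℕ → ℕ} → (∀ k → k < m → f k ≡ 0) →
  sumTo (m + n) f ≡ sumTo n (λ k → f (m + k))
sumTo-shift zero    n     f<m≡0 = refl
sumTo-shift (suc m) n {f} f<m≡0 = begin
  sumTo (suc (m + n)) f                   ≡⟨ sumTo-suc (m + n) f ⟩
  f 0 + sumTo (m + n) (f ∘ suc)           ≡⟨ cong₂ _+_ (f<m≡0 0 z<s) (sumTo-shift m n (λ k k<m → f<m≡0 (suc k) (s<s k<m))) ⟩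
  sumTo n (λ k → f (suc (m + k)))         ∎

vandermonde : ∀ a b r → (a + b) C r ≡ sumTo r (λ i → (a C i) * (b C (r ∸ i)))
vandermonde zero    b r = sym (trans (sumTo-extend 0 r 0Ck≡0) (+-identityʳ (b C r)))
  where
  0Ck≡0 : ∀ k → 0 < k → (0 C k) * (b C (r ∸ k)) ≡ 0
  0Ck≡0 (suc k) _ = refl
vandermonde (suc a) b zero    = refl
vandermonde (suc a) b (suc r) = begin
  suc (a + b) C suc r
    ≡⟨ nCk+nC[k+1]≡[n+1]C[k+1] (a + b) r ⟨
  (a + b) C r + (a + b) C suc r
    ≡⟨ cong₂ _+_ (vandermonde a b r) (trans (vandermonde a b (suc r)) (sumTo-suc r _)) ⟩
  S + (1 * (b C suc r) + S₊)
    ≡⟨ cong (λ y → S + (y + S₊)) (*-identityˡ (b C suc r)) ⟩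
  S + (b C suc r + S₊)
    ≡⟨ x+[y+z]≡y+[x+z] S (b C suc r) S₊ ⟩
  b C suc r + (S + S₊)
    ≡⟨ cong (b C suc r +_) (sumTo-distrib-+ r _ _) ⟨
  b C suc r + sumTo r (λ i → (a C i) * (b C (r ∸ i)) + (a C suc i) * (b C (r ∸ i)))
    ≡⟨ cong (b C suc r +_) (sumTo-cong r (λ i _ → pascal i)) ⟩
  b C suc r + sumTo r (λ i → (suc a C suc i) * (b C (r ∸ i)))
    ≡⟨ cong (_+ sumTo r (λ i → (suc a C suc i) * (b C (r ∸ i)))) (*-identityˡ (b C suc r)) ⟨
  1 * (b C suc r) + sumTo r (λ i → (suc a C suc i) * (b C (r ∸ i)))
    ≡⟨ sumTo-suc r _ ⟨
  sumTo (suc r) (λ i → (suc a C i) * (b C (suc r ∸ i))) ∎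
  where
  S S₊ : ℕ
  S  = sumTo r (λ i → (a C i) * (b C (r ∸ i)))
  S₊ = sumTo r (λ i → (a C suc i) * (b C (r ∸ i)))
  pascal : ∀ i → (a C i) * (b C (r ∸ i)) + (a C suc i) * (b C (r ∸ i)) ≡ (suc a C suc i) * (b C (r ∸ i))
  pascal i = trans (sym (*-distribʳ-+ (b C (r ∸ i)) (a C i) (a C suc i)))
                   (cong (_* (b C (r ∸ i))) (nCk+nC[k+1]≡[n+1]C[k+1] a i))

[n∸j]∸[k∸j]≡n∸k : ∀ n {j k} → j ≤ k → (n ∸ j) ∸ (k ∸ j) ≡ n ∸ k
[n∸j]∸[k∸j]≡n∸k n {j} {k} j≤k = trans (∸-+-assoc n j (k ∸ j)) (cong (n ∸_) (m+[n∸m]≡n j≤k))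

2*n∸j≡n+[n∸j] : ∀ {n j} → j ≤ n → 2 * n ∸ j ≡ n + (n ∸ j)
2*n∸j≡n+[n∸j] {n} {j} j≤n = trans (cong (λ y → n + y ∸ j) (+-identityʳ n)) (+-∸-assoc n j≤n)

a*nCk*-cong : ∀ a n k {b c} → (k ≤ n → b ≡ c) → a * (n C k) * b ≡ a * (n C k) * c
a*nCk*-cong a n k b≡c with k ≤? n
... | yes k≤n = cong (a * (n C k) *_) (b≡c k≤n)
... | no  k≰n rewrite k>n⇒nCk≡0 (≰⇒> k≰n) | *-zeroʳ a = refl

nCk*[k!*[n∸k]!]≡n! : ∀ {n k} → k ≤ n → (n C k) * (k ! * (n ∸ k) !) ≡ n !
nCk*[k!*[n∸k]!]≡n! {n} {k} k≤n =
  trans (cong (_* (k ! * (n ∸ k) !)) (nCk≡n!/k![n-k]! k≤n))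
        (m/n*n≡m {{k !* (n ∸ k) !≢0}} (k![n∸k]!∣n! k≤n))

nCk*kCj≡nCj*[n∸j]C[k∸j] : ∀ n k j → j ≤ k → (n C k) * (k C j) ≡ (n C j) * ((n ∸ j) C (k ∸ j))
nCk*kCj≡nCj*[n∸j]C[k∸j] n k j j≤k with k ≤? n
... | no k≰n = begin
  (n C k) * (k C j)               ≡⟨ cong (_* (k C j)) (k>n⇒nCk≡0 (≰⇒> k≰n)) ⟩
  0                               ≡⟨ rhs≡0 (j ≤? n) ⟨
  (n C j) * ((n ∸ j) C (k ∸ j))   ∎
  where
  rhs≡0 : Dec (j ≤ n) → (n C j) * ((n ∸ j) C (k ∸ j)) ≡ 0
  rhs≡0 (yes j≤n) = trans (cong ((n C j) *_) (k>n⇒nCk≡0 (∸-monoˡ-< (≰⇒> k≰n) j≤n))) (*-zeroʳ (n C j))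
  rhs≡0 (no  j≰n) = cong (_* ((n ∸ j) C (k ∸ j))) (k>n⇒nCk≡0 (≰⇒> j≰n))
... | yes k≤n = *-cancelʳ-≡ _ _ (j ! * ((k ∸ j) ! * (n ∸ k) !)) {{factorials≢0}} (trans lhs≡n! (sym rhs≡n!))
  where
  factorials≢0 : NonZero (j ! * ((k ∸ j) ! * (n ∸ k) !))
  factorials≢0 = m*n≢0 (j !) _ {{j !≢0}} {{(k ∸ j) !* (n ∸ k) !≢0}}
  lhs≡n! : (n C k) * (k C j) * (j ! * ((k ∸ j) ! * (n ∸ k) !)) ≡ n !
  lhs≡n! = begin
    (n C k) * (k C j) * (j ! * ((k ∸ j) ! * (n ∸ k) !))
      ≡⟨ solve 5 (λ x y p q r → x :* y :* (p :* (q :* r)) := x :* (y :* (p :* q) :* r)) refl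
               (n C k) (k C j) (j !) ((k ∸ j) !) ((n ∸ k) !) ⟩
    (n C k) * ((k C j) * (j ! * (k ∸ j) !) * (n ∸ k) !)
      ≡⟨ cong (λ y → (n C k) * (y * (n ∸ k) !)) (nCk*[k!*[n∸k]!]≡n! j≤k) ⟩
    (n C k) * (k ! * (n ∸ k) !)
      ≡⟨ nCk*[k!*[n∸k]!]≡n! k≤n ⟩
    n ! ∎
  rhs≡n! : (n C j) * ((n ∸ j) C (k ∸ j)) * (j ! * ((k ∸ j) ! * (n ∸ k) !)) ≡ n !
  rhs≡n! = begin
    (n C j) * ((n ∸ j) C (k ∸ j)) * (j ! * ((k ∸ j) ! * (n ∸ k) !))
      ≡⟨ solve 5 (λ x y p q r → x :* y :* (p :* (q :* r)) := x :* (p :* (y :* (q :* r)))) refl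
               (n C j) ((n ∸ j) C (k ∸ j)) (j !) ((k ∸ j) !) ((n ∸ k) !) ⟩
    (n C j) * (j ! * (((n ∸ j) C (k ∸ j)) * ((k ∸ j) ! * (n ∸ k) !)))
      ≡⟨ cong (λ y → (n C j) * (j ! * (((n ∸ j) C (k ∸ j)) * ((k ∸ j) ! * y !)))) ([n∸j]∸[k∸j]≡n∸k n j≤k) ⟨
    (n C j) * (j ! * (((n ∸ j) C (k ∸ j)) * ((k ∸ j) ! * ((n ∸ j) ∸ (k ∸ j)) !)))
      ≡⟨ cong (λ y → (n C j) * (j ! * y)) (nCk*[k!*[n∸k]!]≡n! (∸-monoˡ-≤ j k≤n)) ⟩
    (n C j) * (j ! * (n ∸ j) !)
      ≡⟨ nCk*[k!*[n∸k]!]≡n! (≤-trans j≤k k≤n) ⟩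
    n ! ∎

nCk*[n∸k]Cj≡nCj*[n∸j]Ck : ∀ n k j → (n C k) * ((n ∸ k) C j) ≡ (n C j) * ((n ∸ j) C k)
nCk*[n∸k]Cj≡nCj*[n∸j]Ck n k j = begin
  (n C k) * ((n ∸ k) C j)               ≡⟨ cong (λ y → (n C k) * ((n ∸ k) C y)) (m+n∸m≡n k j) ⟨
  (n C k) * ((n ∸ k) C (k + j ∸ k))     ≡⟨ nCk*kCj≡nCj*[n∸j]C[k∸j] n (k + j) k (m≤m+n k j) ⟨
  (n C (k + j)) * ((k + j) C k)         ≡⟨ cong ((n C (k + j)) *_) (k+jCk≡k+jCj k j) ⟩
  (n C (k + j)) * ((k + j) C j)         ≡⟨ cong (λ y → (n C y) * (y C j)) (+-comm k j) ⟩
  (n C (j + k)) * ((j + k) C j)         ≡⟨ nCk*kCj≡nCj*[n∸j]C[k∸j] n (j + k) j (m≤m+n j k) ⟩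
  (n C j) * ((n ∸ j) C (j + k ∸ j))     ≡⟨ cong (λ y → (n C j) * ((n ∸ j) C y)) (m+n∸m≡n j k) ⟩
  (n C j) * ((n ∸ j) C k)               ∎
  where
  k+jCk≡k+jCj : ∀ k j → (k + j) C k ≡ (k + j) C j
  k+jCk≡k+jCj k j = trans (nCk≡nC[n∸k] (m≤m+n k j)) (cong ((k + j) C_) (m+n∸m≡n k j))

nCk*kCj≡nCj*[n∸j]C[n∸k] : ∀ {n k j} → k ≤ n → j ≤ n → (n C k) * (k C j) ≡ (n C j) * ((n ∸ j) C (n ∸ k))
nCk*kCj≡nCj*[n∸j]C[n∸k] {n} {k} {j} k≤n j≤n with j ≤? k
... | yes j≤k = begin
  (n C k) * (k C j)                           ≡⟨ nCk*kCj≡nCj*[n∸j]C[k∸j] n k j j≤k ⟩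
  (n C j) * ((n ∸ j) C (k ∸ j))               ≡⟨ cong ((n C j) *_) (nCk≡nC[n∸k] (∸-monoˡ-≤ j k≤n)) ⟩
  (n C j) * ((n ∸ j) C ((n ∸ j) ∸ (k ∸ j)))   ≡⟨ cong (λ y → (n C j) * ((n ∸ j) C y)) ([n∸j]∸[k∸j]≡n∸k n j≤k) ⟩
  (n C j) * ((n ∸ j) C (n ∸ k))               ∎
... | no j≰k = begin
  (n C k) * (k C j)                           ≡⟨ cong ((n C k) *_) (k>n⇒nCk≡0 (≰⇒> j≰k)) ⟩
  (n C k) * 0                                 ≡⟨ *-zeroʳ (n C k) ⟩
  0                                           ≡⟨ *-zeroʳ (n C j) ⟨
  (n C j) * 0                                 ≡⟨ cong ((n C j) *_) (k>n⇒nCk≡0 (∸-monoʳ-< (≰⇒> j≰k) j≤n)) ⟨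
  (n C j) * ((n ∸ j) C (n ∸ k))               ∎

sumTo-mCt*pCt≡[p+m]Cm : ∀ m p d → sumTo (m + d) (λ t → (m C t) * (p C t)) ≡ (p + m) C m
sumTo-mCt*pCt≡[p+m]Cm m p d = begin
  sumTo (m + d) (λ t → (m C t) * (p C t))   ≡⟨ sumTo-extend m d (λ t m<t → cong (_* (p C t)) (k>n⇒nCk≡0 m<t)) ⟩
  sumTo m (λ t → (m C t) * (p C t))         ≡⟨ sumTo-cong m (λ t t≤m → symmetrise t t≤m) ⟩
  sumTo m (λ t → (p C t) * (m C (m ∸ t)))   ≡⟨ vandermonde p m m ⟨
  (p + m) C m                               ∎
  where
  symmetrise : ∀ t → t ≤ m → (m C t) * (p C t) ≡ (p C t) * (m C (m ∸ t))
  symmetrise t t≤m = trans (*-comm (m C t) (p C t)) (cong ((p C t) *_) (nCk≡nC[n∸k] t≤m))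

liShanlan : ∀ x m j →
  sumTo (m + j) (λ t → (m C t) * (j C t) * ((x + (m + j ∸ t)) C (m + j)))
  ≡ ((x + m) C m) * ((x + j) C j)
liShanlan x m j = begin
  sumTo N (λ t → (m C t) * (j C t) * ((x + (N ∸ t)) C N))
    ≡⟨ sumTo-cong N (λ t _ → expand t) ⟩
  sumTo N (λ t → sumTo N (λ s → (m C t) * (j C t) * (((x + m) C s) * ((j ∸ t) C (N ∸ s)))))
    ≡⟨ sumTo-comm N N _ ⟩
  sumTo N (λ s → sumTo N (λ t → (m C t) * (j C t) * (((x + m) C s) * ((j ∸ t) C (N ∸ s)))))
    ≡⟨ sumTo-cong N (λ s _ → collect s) ⟩
  sumTo N (λ s → ((x + m) C s) * (j C (N ∸ s)) * sumTo N (λ t → (m C t) * ((j ∸ (N ∸ s)) C t)))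
    ≡⟨ sumTo-cong N (λ s _ → cong (((x + m) C s) * (j C (N ∸ s)) *_) (sumTo-mCt*pCt≡[p+m]Cm m (j ∸ (N ∸ s)) j)) ⟩
  sumTo N g
    ≡⟨ sumTo-shift m j g<m≡0 ⟩
  sumTo j (λ u → g (m + u))
    ≡⟨ sumTo-cong j g[m+u] ⟩
  sumTo j (λ u → ((x + m) C m) * ((x C u) * (j C (j ∸ u))))
    ≡⟨ *-distribˡ-sumTo j ((x + m) C m) _ ⟨
  ((x + m) C m) * sumTo j (λ u → (x C u) * (j C (j ∸ u)))
    ≡⟨ cong (((x + m) C m) *_) (vandermonde x j j) ⟨
  ((x + m) C m) * ((x + j) C j) ∎
  where
  N : ℕ
  N = m + j

  expand : ∀ t → (m C t) * (j C t) * ((x + (N ∸ t)) C N)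
                 ≡ sumTo N (λ s → (m C t) * (j C t) * (((x + m) C s) * ((j ∸ t) C (N ∸ s))))
  expand t = begin
    (m C t) * (j C t) * ((x + (N ∸ t)) C N)
      ≡⟨ a*nCk*-cong (m C t) j t (λ t≤j → cong (_C N) (x+[N∸t]≡x+m+[j∸t] t≤j)) ⟩
    (m C t) * (j C t) * ((x + m + (j ∸ t)) C N)
      ≡⟨ cong ((m C t) * (j C t) *_) (vandermonde (x + m) (j ∸ t) N) ⟩
    (m C t) * (j C t) * sumTo N (λ s → ((x + m) C s) * ((j ∸ t) C (N ∸ s)))
      ≡⟨ *-distribˡ-sumTo N ((m C t) * (j C t)) _ ⟩
    sumTo N (λ s → (m C t) * (j C t) * (((x + m) C s) * ((j ∸ t) C (N ∸ s)))) ∎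
    where
    x+[N∸t]≡x+m+[j∸t] : t ≤ j → x + (N ∸ t) ≡ x + m + (j ∸ t)
    x+[N∸t]≡x+m+[j∸t] t≤j = trans (cong (x +_) (+-∸-assoc m t≤j)) (sym (+-assoc x m (j ∸ t)))

  regroup : ∀ s t → (m C t) * (j C t) * (((x + m) C s) * ((j ∸ t) C (N ∸ s)))
                    ≡ ((x + m) C s) * (j C (N ∸ s)) * ((m C t) * ((j ∸ (N ∸ s)) C t))
  regroup s t = begin
    (m C t) * (j C t) * (((x + m) C s) * ((j ∸ t) C r))
      ≡⟨ solve 4 (λ a b c d → a :* b :* (c :* d) := c :* (a :* (b :* d))) refl (m C t) (j C t) ((x + m) C s) ((j ∸ t) C r) ⟩
    ((x + m) C s) * ((m C t) * ((j C t) * ((j ∸ t) C r)))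
      ≡⟨ cong (λ y → ((x + m) C s) * ((m C t) * y)) (nCk*[n∸k]Cj≡nCj*[n∸j]Ck j t r) ⟩
    ((x + m) C s) * ((m C t) * ((j C r) * ((j ∸ r) C t)))
      ≡⟨ solve 4 (λ c a e f → c :* (a :* (e :* f)) := c :* e :* (a :* f)) refl ((x + m) C s) (m C t) (j C r) ((j ∸ r) C t) ⟩
    ((x + m) C s) * (j C r) * ((m C t) * ((j ∸ r) C t)) ∎
    where
    r : ℕ
    r = N ∸ s

  collect : ∀ s → sumTo N (λ t → (m C t) * (j C t) * (((x + m) C s) * ((j ∸ t) C (N ∸ s))))
                  ≡ ((x + m) C s) * (j C (N ∸ s)) * sumTo N (λ t → (m C t) * ((j ∸ (N ∸ s)) C t))
  collect s = trans (sumTo-cong N (λ t _ → regroup s t)) (sym (*-distribˡ-sumTo N (((x + m) C s) * (j C (N ∸ s))) _))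

  g : ℕ → ℕ
  g s = ((x + m) C s) * (j C (N ∸ s)) * ((j ∸ (N ∸ s) + m) C m)

  g<m≡0 : ∀ s → s < m → g s ≡ 0
  g<m≡0 s s<m = begin
    g s                                              ≡⟨ cong (λ y → ((x + m) C s) * y * ((j ∸ (N ∸ s) + m) C m)) (k>n⇒nCk≡0 j<N∸s) ⟩
    ((x + m) C s) * 0 * ((j ∸ (N ∸ s) + m) C m)      ≡⟨ cong (_* ((j ∸ (N ∸ s) + m) C m)) (*-zeroʳ ((x + m) C s)) ⟩
    0                                                ∎
    where
    j<N∸s : j < N ∸ s
    j<N∸s = subst (j <_) (sym (+-∸-comm j (<⇒≤ s<m))) (m<n+m j (m<n⇒0<n∸m s<m))

  g[m+u] : ∀ u → u ≤ j → g (m + u) ≡ ((x + m) C m) * ((x C u) * (j C (j ∸ u)))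
  g[m+u] u u≤j = begin
    ((x + m) C (m + u)) * (j C (N ∸ (m + u))) * ((j ∸ (N ∸ (m + u)) + m) C m)
      ≡⟨ cong (λ y → ((x + m) C (m + u)) * (j C y) * ((j ∸ y + m) C m)) ([m+n]∸[m+o]≡n∸o m j u) ⟩
    ((x + m) C (m + u)) * (j C (j ∸ u)) * ((j ∸ (j ∸ u) + m) C m)
      ≡⟨ cong (λ y → ((x + m) C (m + u)) * (j C (j ∸ u)) * (y C m)) (trans (cong (_+ m) (m∸[m∸n]≡n u≤j)) (+-comm u m)) ⟩
    ((x + m) C (m + u)) * (j C (j ∸ u)) * ((m + u) C m)
      ≡⟨ [x*y]*z≡[x*z]*y ((x + m) C (m + u)) (j C (j ∸ u)) ((m + u) C m) ⟩
    ((x + m) C (m + u)) * ((m + u) C m) * (j C (j ∸ u))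
      ≡⟨ cong (_* (j C (j ∸ u))) (nCk*kCj≡nCj*[n∸j]C[k∸j] (x + m) (m + u) m (m≤m+n m u)) ⟩
    ((x + m) C m) * ((x + m ∸ m) C (m + u ∸ m)) * (j C (j ∸ u))
      ≡⟨ cong₂ (λ y z → ((x + m) C m) * (y C z) * (j C (j ∸ u))) (m+n∸n≡m x m) (m+n∸m≡n m u) ⟩
    ((x + m) C m) * (x C u) * (j C (j ∸ u))
      ≡⟨ *-assoc ((x + m) C m) (x C u) (j C (j ∸ u)) ⟩
    ((x + m) C m) * ((x C u) * (j C (j ∸ u))) ∎

sumTo-nCk²*[n+k]Cn*kCj*kCm : ∀ {n} m j → m + j ≡ n →
  sumTo n (λ k → ((n C k) ^ 2) * ((n + k) C n) * ((k C j) * (k C m)))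
  ≡ ((n C j) ^ 2) * ((n + j) C j) * ((n + m) C n)
sumTo-nCk²*[n+k]Cn*kCj*kCm m j refl = begin
  sumTo N (λ k → ((N C k) ^ 2) * ((N + k) C N) * ((k C j) * (k C m)))
    ≡⟨ sumTo-cong N (λ k k≤N → factor k k≤N) ⟩
  sumTo N (λ k → ((N C j) * (N C m)) * ((m C (N ∸ k)) * (j C (N ∸ k)) * ((N + k) C N)))
    ≡⟨ *-distribˡ-sumTo N ((N C j) * (N C m)) _ ⟨
  ((N C j) * (N C m)) * sumTo N (λ k → (m C (N ∸ k)) * (j C (N ∸ k)) * ((N + k) C N))
    ≡⟨ cong (((N C j) * (N C m)) *_) (sumTo-cong N (λ k k≤N → cong (λ y → (m C (N ∸ k)) * (j C (N ∸ k)) * ((N + y) C N)) (sym (m∸[m∸n]≡n k≤N)))) ⟩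
  ((N C j) * (N C m)) * sumTo N (λ k → f (N ∸ k))
    ≡⟨ cong (((N C j) * (N C m)) *_) (sumTo-reverse N f) ⟨
  ((N C j) * (N C m)) * sumTo N f
    ≡⟨ cong (((N C j) * (N C m)) *_) (liShanlan N m j) ⟩
  ((N C j) * (N C m)) * (((N + m) C m) * ((N + j) C j))
    ≡⟨ cong₂ (λ y z → ((N C j) * y) * (z * ((N + j) C j))) NCm≡NCj [N+m]Cm≡[N+m]CN ⟩
  ((N C j) * (N C j)) * (((N + m) C N) * ((N + j) C j))
    ≡⟨ solve 3 (λ a b c → (a :* a) :* (b :* c) := (a :^ 2) :* c :* b) refl (N C j) ((N + m) C N) ((N + j) C j) ⟩
  ((N C j) ^ 2) * ((N + j) C j) * ((N + m) C N) ∎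
  where
  N : ℕ
  N = m + j

  f : ℕ → ℕ
  f t = (m C t) * (j C t) * ((N + (N ∸ t)) C N)

  factor : ∀ k → k ≤ N →
    ((N C k) ^ 2) * ((N + k) C N) * ((k C j) * (k C m))
    ≡ ((N C j) * (N C m)) * ((m C (N ∸ k)) * (j C (N ∸ k)) * ((N + k) C N))
  factor k k≤N = begin
    ((N C k) ^ 2) * ((N + k) C N) * ((k C j) * (k C m))
      ≡⟨ solve 4 (λ a b c d → (a :^ 2) :* b :* (c :* d) := (a :* c) :* (a :* d) :* b) refl
               (N C k) ((N + k) C N) (k C j) (k C m) ⟩
    ((N C k) * (k C j)) * ((N C k) * (k C m)) * ((N + k) C N)
      ≡⟨ cong₂ (λ y z → y * z * ((N + k) C N))
               (trans (nCk*kCj≡nCj*[n∸j]C[n∸k] k≤N (m≤n+m j m)) (cong (λ y → (N C j) * (y C (N ∸ k))) (m+n∸n≡m m j)))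
               (trans (nCk*kCj≡nCj*[n∸j]C[n∸k] k≤N (m≤m+n m j)) (cong (λ y → (N C m) * (y C (N ∸ k))) (m+n∸m≡n m j))) ⟩
    ((N C j) * (m C (N ∸ k))) * ((N C m) * (j C (N ∸ k))) * ((N + k) C N)
      ≡⟨ solve 5 (λ a b c d e → (a :* b) :* (c :* d) :* e := (a :* c) :* (b :* d :* e)) refl
               (N C j) (m C (N ∸ k)) (N C m) (j C (N ∸ k)) ((N + k) C N) ⟩
    ((N C j) * (N C m)) * ((m C (N ∸ k)) * (j C (N ∸ k)) * ((N + k) C N)) ∎

  NCm≡NCj : N C m ≡ N C j
  NCm≡NCj = trans (cong (N C_) (sym (m+n∸n≡m m j))) (sym (nCk≡nC[n∸k] (m≤n+m j m)))

  [N+m]Cm≡[N+m]CN : (N + m) C m ≡ (N + m) C N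
  [N+m]Cm≡[N+m]CN = trans (nCk≡nC[n∸k] (m≤n+m m N)) (cong ((N + m) C_) (m+n∸n≡m N m))

mainTheorem13 : (n : ℕ) →
    ((2 * n) C n) * sumTo n (λ k → ((n C k) ^ 2) * ((n + k) C n) * ((2 * k) C n))
      ≡ ((2 * n) C n) * sumTo n (λ k → ((n C k) ^ 2) * ((n + k) C k) * ((2 * n ∸ k) C n))
mainTheorem13 n = cong (((2 * n) C n) *_) (begin
  sumTo n (λ k → a k * ((2 * k) C n))
    ≡⟨ sumTo-cong n (λ k _ → cong (λ y → a k * (y C n)) (cong (k +_) (+-identityʳ k))) ⟩
  sumTo n (λ k → a k * ((k + k) C n))
    ≡⟨ sumTo-cong n (λ k _ → trans (cong (a k *_) (vandermonde k k n)) (*-distribˡ-sumTo n (a k) _)) ⟩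
  sumTo n (λ k → sumTo n (λ j → a k * ((k C j) * (k C (n ∸ j)))))
    ≡⟨ sumTo-comm n n _ ⟩
  sumTo n (λ j → sumTo n (λ k → a k * ((k C j) * (k C (n ∸ j)))))
    ≡⟨ sumTo-cong n (λ j j≤n → sumTo-nCk²*[n+k]Cn*kCj*kCm (n ∸ j) j (m∸n+n≡m j≤n)) ⟩
  sumTo n (λ j → ((n C j) ^ 2) * ((n + j) C j) * ((n + (n ∸ j)) C n))
    ≡⟨ sumTo-cong n (λ j j≤n → cong (λ y → ((n C j) ^ 2) * ((n + j) C j) * (y C n)) (2*n∸j≡n+[n∸j] j≤n)) ⟨
  sumTo n (λ j → ((n C j) ^ 2) * ((n + j) C j) * ((2 * n ∸ j) C n)) ∎)
  where
  a : ℕ → ℕ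
  a k = ((n C k) ^ 2) * ((n + k) C n)
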